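{- For a positive integer $n$, let $\sigma_n=(n,n-1,n-2,\ldots,1)$ denote the staircase partition. Then $$\mathrm{SG}(\mathrm{LCTR}(\sigma_n)) = n \bmod 2\quad \text{and}\quad \mathrm{SG}(\mathrm{Downright}(\sigma_n)) = (n-1) \bmod 2.$$
   Context: A partition $\lambda=(\lambda_1,\dots,\lambda_r)$ with $\lambda_1\ge\dots\ge\lambda_r>0$ is identified with its Young diagram. For integers $i,j\ge 0$, $\lambda[i,j]$ denotes the subpartition obtained by deleting the top $i$ rows and the leftmost $j$ columns (trailing nonpositive parts removed; it is the empty partition $()$ if nothing remains). In the impartial game LCTR played on $\lambda$, a move replaces $\lambda$ by $\lambda[1,0]$ (remove the top row) or by $\lambda[0,1]$ (remove the left column); the empty partition $()$ is the terminal position. In the impartial game Downright played on $\lambda$ (a rook in the top-left box moving one box down or right within the diagram), the move to $\lambda[1,0]$ is allowed when $r>1$ and the move to $\lambda[0,1]$ is allowed when $\lambda_1>1$; so the terminal position is $(1)$. Both games are under normal play, and $\mathrm{SG}$ denotes the Sprague-Grundy value, $\mathrm{SG}(A)=\mathrm{mex}\{\mathrm{SG}(B): A\to B\}$. -}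

module Defs where

open import Data.Nat using (ℕ; zero; suc; _<_; _<?_; _≟_)
open import Data.List using (List; []; _∷_; filter; map; length)
open import Data.Nat.ListAction using (sum)
open import Data.Bool using (Bool; true; false; if_then_else_)
open import Relation.Nullary using (does)

-- A partition (λ₁ ≥ … ≥ λ_r > 0) is represented by the list of its parts.
Partition : Set
Partition = List ℕ

size : Partition → ℕ
size = sum

delRow : Partition → Partition
delRow []       = []
delRow (_ ∷ xs) = xs

delCol : Partition → Partition
delCol xs = filter (0 <?_) (map Data.Nat.pred xs)

elem : ℕ → List ℕ → Bool
elem k []       = false
elem k (x ∷ xs) = if does (k ≟ x) then true else elem k xs

-- mex: least natural number not in the list (it is ≤ length of the list,
-- so searching up to the length suffices).
mexAux : ℕ → ℕ → List ℕ → ℕ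
mexAux zero    k xs = k
mexAux (suc f) k xs = if elem k xs then mexAux f (suc k) xs else k

mex : List ℕ → ℕ
mex xs = mexAux (length xs) 0 xs

lctrMoves : Partition → List Partition
lctrMoves []         = []
lctrMoves p@(_ ∷ _)  = delRow p ∷ delCol p ∷ []

drMoves : Partition → List Partition
drMoves []             = []
drMoves p@(x ∷ xs) = rowMove xs (colMove x)
  where
  colMove : ℕ → List Partition
  colMove (suc (suc _)) = delCol p ∷ []
  colMove _             = []
  rowMove : List ℕ → List Partition → List Partition
  rowMove []      ms = ms
  rowMove (_ ∷ _) ms = delRow p ∷ ms

-- Sprague–Grundy value computed by recursion with fuel; every move strictly
-- decreases the number of boxes, so fuel = size suffices.
sgFuel : (Partition → List Partition) → ℕ → Partition → ℕ
sgFuel moves zero    p = 0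
sgFuel moves (suc f) p = mex (map (sgFuel moves f) (moves p))

SG-LCTR : Partition → ℕ
SG-LCTR p = sgFuel lctrMoves (size p) p

SG-Downright : Partition → ℕ
SG-Downright p = sgFuel drMoves (size p) p

staircase : ℕ → Partition
staircase zero    = []
staircase (suc n) = suc n ∷ staircase n

-- Deleting either the top row or the left column of σₙ₊₁ leaves σₙ, so every
-- position σₙ₊₁ has the single option value SG(σₙ), and mex {v} = 1 - v for
-- v ∈ {0, 1}.  The values therefore alternate, starting from SG(σ₀) = 0 for
-- LCTR and from the terminal position SG(σ₁) = 0 for Downright.
module Submission where

open import Defs
open import Data.Nat using (ℕ; _≤_; _∸_; _%_; zero; suc; s≤s; z≤n)
open import Data.Nat.Properties using (m≤m+n)
open import Data.Product using (_×_; _,_)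
open import Data.List using ([]; _∷_)
open import Relation.Binary.PropositionalEquality using (_≡_; refl; cong)

mex-parity : (m : ℕ) → mex (m % 2 ∷ m % 2 ∷ []) ≡ suc m % 2
mex-parity zero          = refl
mex-parity (suc zero)    = refl
mex-parity (suc (suc m)) = mex-parity m

delCol-staircase : (n : ℕ) → delCol (staircase (suc n)) ≡ staircase n
delCol-staircase zero    = refl
delCol-staircase (suc n) = cong (suc n ∷_) (delCol-staircase n)

n≤size-staircase : (n : ℕ) → n ≤ size (staircase n)
n≤size-staircase zero    = z≤n
n≤size-staircase (suc n) = m≤m+n (suc n) _

sgFuel-lctr-staircase : (n f : ℕ) → n ≤ f →
  sgFuel lctrMoves f (staircase n) ≡ n % 2
sgFuel-lctr-staircase zero    zero    _ = refl
sgFuel-lctr-staircase zero    (suc f) _ = refl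
sgFuel-lctr-staircase (suc n) (suc f) (s≤s n≤f)
  rewrite delCol-staircase n | sgFuel-lctr-staircase n f n≤f = mex-parity n

sgFuel-downright-staircase : (n f : ℕ) → n ≤ f →
  sgFuel drMoves f (staircase n) ≡ (n ∸ 1) % 2
sgFuel-downright-staircase zero          zero    _ = refl
sgFuel-downright-staircase zero          (suc f) _ = refl
sgFuel-downright-staircase (suc zero)    (suc f) _ = refl
sgFuel-downright-staircase (suc (suc n)) (suc f) (s≤s n≤f)
  rewrite delCol-staircase (suc n) | sgFuel-downright-staircase (suc n) f n≤f
  = mex-parity n

lemma3p1 : (n : ℕ) → 1 ≤ n →
    (SG-LCTR (staircase n) ≡ n % 2) × (SG-Downright (staircase n) ≡ (n ∸ 1) % 2)
lemma3p1 n _ =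
  sgFuel-lctr-staircase n _ (n≤size-staircase n) ,
  sgFuel-downright-staircase n _ (n≤size-staircase n)
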